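{- Let $G$ be a finite simple graph with minimum degree $\delta(G)$. Then $Z(G)=\delta(G)$ if and only if $G$ is a graph of $\delta(G)$ internally parallel paths.
   Context: Zero forcing: initially a set $S$ is colored blue; the color-change rule colors blue the unique non-blue neighbor of a blue vertex having exactly one non-blue neighbor, applied as long as possible; $S$ is a zero forcing set if eventually all vertices are blue, and $Z(G)$ is the minimum size of a zero forcing set. For a path $P: a_1,\ldots,a_m$ and a vertex $a_i$ of $P$, ${}^{a_i}P$ denotes the subpath $a_{i+1},\ldots,a_m$. $G$ is a graph of $k$ internally parallel paths if there is a vertex $x\in V(G)$ and $k$ paths $Q_1,\ldots,Q_k$, each an induced path of $G$ having $x$ as an end-vertex, with $V(Q_i)\cap V(Q_j)=\{x\}$ for $i\ne j$ and $V(G)=\bigcup_{i=1}^k V(Q_i)$ (so $E(G)$ consists of the path edges together with any number of edges joining vertices of different paths), such that: for every choice of $\ell\le k$ vertices $x_{i_1}\in V(Q_{i_1}),\ldots,x_{i_\ell}\in V(Q_{i_\ell})$ on pairwise distinct paths, none an end-vertex of its path, there exists $x'\in\{x_{i_1},\ldots,x_{i_\ell}\}$ with exactly one neighbor in $Y=V({}^{x_{i_1}}Q_{i_1})\cup\cdots\cup V({}^{x_{i_\ell}}Q_{i_\ell})$, where each $Q_i$ is traversed starting from $x$. -}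

module Defs where

open import Data.Nat using (ℕ; zero; suc; _≤_; _<_; _⊓_)
open import Data.Fin using (Fin; toℕ)
open import Data.Fin.Subset using (Subset; _∈_; ∣_∣)
open import Data.Bool using (Bool; true; false)
open import Data.Vec using (Vec; tabulate; foldr₁)
open import Data.List using (List; _∷_; length; lookup; drop)
open import Data.List.Relation.Unary.Unique.Propositional using (Unique)
import Data.List.Membership.Propositional as ListMem
open import Data.Maybe using (Maybe; just)
open import Data.Product using (Σ; _×_; ∃; ∃-syntax)
open import Data.Sum using (_⊎_)
open import Relation.Binary.PropositionalEquality using (_≡_; _≢_)
open import Relation.Nullary using (¬_)

record Graph (n : ℕ) : Set where
  field
    adj    : Fin n → Fin n → Bool
    sym    : ∀ u v → adj u v ≡ adj v u
    irrefl : ∀ v → adj v v ≡ false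

open Graph public

Adj : ∀ {n} → Graph n → Fin n → Fin n → Set
Adj G u v = adj G u v ≡ true

nbhd : ∀ {n} → Graph n → Fin n → Subset n
nbhd G v = tabulate (adj G v)

degree : ∀ {n} → Graph n → Fin n → ℕ
degree G v = ∣ nbhd G v ∣

minDegree : ∀ {n} → Graph (suc n) → ℕ
minDegree G = foldr₁ _⊓_ (tabulate (degree G))

-- Blue G S v : v is eventually coloured blue when S is initially blue and
-- the colour-change rule is applied as long as possible (least set
-- containing S and closed under the colour-change rule: a blue vertex u
-- all of whose neighbours other than v are blue forces its neighbour v).

data Blue {n} (G : Graph n) (S : Subset n) : Fin n → Set where
  initial : ∀ {v} → v ∈ S → Blue G S v
  force   : ∀ {u v} → Blue G S u → Adj G u v →
            (∀ w → Adj G u w → w ≢ v → Blue G S w) → Blue G S v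

IsZeroForcingSet : ∀ {n} → Graph n → Subset n → Set
IsZeroForcingSet G S = ∀ v → Blue G S v

ZeroForcingNumberIs : ∀ {n} → Graph n → ℕ → Set
ZeroForcingNumberIs G k =
  (Σ (Subset _) λ S → IsZeroForcingSet G S × ∣ S ∣ ≡ k)
  × (∀ S → IsZeroForcingSet G S → k ≤ ∣ S ∣)

IsInducedPath : ∀ {n} → Graph n → List (Fin n) → Set
IsInducedPath G p =
  Unique p ×
  (∀ i j → Adj G (lookup p i) (lookup p j) ⇔′ (suc (toℕ i) ≡ toℕ j ⊎ suc (toℕ j) ≡ toℕ i))
  where
  _⇔′_ : Set → Set → Set
  A ⇔′ B = (A → B) × (B → A)

-- The path Q_i is x ∷ Q i (traversed
-- starting from x); Q i is the list of its vertices other than x.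
-- A choice assigns to each path Q_i either nothing or a position j in Q i;
-- the chosen vertex lookup (Q i) j is a non-end vertex of Q_i iff it is not
-- the last entry of Q i (it is never x).  Its subpath ^{x_i}Q_i is
-- drop (1 + j) (Q i).

module _ {n} (G : Graph n) where

  ExactlyOneNeighbourIn : Fin n → (Fin n → Set) → Set
  ExactlyOneNeighbourIn v Y =
    Σ (Fin n) λ y → (Y y × Adj G v y) × (∀ z → Y z → Adj G v z → z ≡ y)

  IsGraphOfInternallyParallelPaths : ℕ → Set
  IsGraphOfInternallyParallelPaths k =
    Σ (Fin n) λ x → Σ (Fin k → List (Fin n)) λ Q →
      (∀ i → IsInducedPath G (x ∷ Q i))
      × (∀ i j → i ≢ j → ∀ v → v ListMem.∈ Q i → ¬ (v ListMem.∈ Q j))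
      × (∀ v → ∃[ i ] (v ListMem.∈ (x ∷ Q i)))
      × (∀ (c : (i : Fin k) → Maybe (Fin (length (Q i)))) →
           (∃[ i ] ∃[ j ] (c i ≡ just j)) →
           (∀ i j → c i ≡ just j → suc (toℕ j) < length (Q i)) →
           let Y : Fin n → Set
               Y v = ∃[ i ] ∃[ j ] (c i ≡ just j × v ListMem.∈ drop (suc (toℕ j)) (Q i))
           in ∃[ i ] ∃[ j ] (c i ≡ just j × ExactlyOneNeighbourIn (lookup (Q i) j) Y))

-- Every zero forcing set S has at least δ vertices: the first vertex x of S to force has
-- all its neighbours but one in S.  If |S| = δ this count is tight, so deg x = δ and
-- S ⊆ N[x]; the forcing chains starting at the δ neighbours of x, prolonged by x, are then
-- induced paths covering G.  They satisfy the choice condition because it is maintained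
-- force by force: a vertex that has already forced has no neighbour beyond the chain ends,
-- so a witness for the chains before a force remains one afterwards, unless the forcer is
-- the only chosen vertex, and then its unique neighbour beyond is the vertex it forced.
-- Conversely, given δ internally parallel paths from x, colour x and the first vertices of
-- all paths but one; x forces the remaining first vertex, and choosing the last blue vertex
-- of every unfinished path, the choice condition yields a vertex with exactly one non-blue
-- neighbour, which it forces.

module Submission where

open import Defs hiding (sym)
open import Data.Bool using (true)
open import Data.Bool.Properties using () renaming (_≟_ to _≟ᵇ_)
open import Data.Empty using (⊥-elim)
open import Data.Fin using (Fin; toℕ; fromℕ<) renaming (zero to fzero; suc to fsuc)
open import Data.Fin.Properties using (_≟_; toℕ-fromℕ<; any?; all?; ¬∀⟶∃¬)
  renaming (suc-injective to fsuc-injective)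
open import Data.Fin.Subset using (Subset; _∈_; _∉_; _⊆_; _⊂_; _∪_; _-_; ⁅_⁆; ⊥; ⊤; ∣_∣; inside; outside)
open import Data.Fin.Subset.Properties
  using (_∈?_; ∈⊤; ∣⊤∣≡n; ∣⊥∣≡0; ∣⁅x⁆∣≡1; ∣p∣≤n; x∈⁅x⁆; x∈p∪q⁺; p─⊥≡p; p─q⊆p; x∈p∧x≢y⇒x∈p-y;
         x∈p⇒∣p-x∣<∣p∣; p⊆q⇒∣p∣≤∣q∣; p⊂q⇒∣p∣<∣q∣; s⊆s; out⊆)
open import Data.List using (List; []; _∷_; [_]; _++_; _∷ʳ_; length; lookup; drop; head)
open import Data.List.Membership.Propositional using () renaming (_∈_ to _∈ₗ_)
open import Data.List.Relation.Unary.All using ([]; _∷_)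
open import Data.List.Relation.Unary.AllPairs using ([]; _∷_)
open import Data.List.Relation.Unary.Any using (here; there)
open import Data.List.Relation.Unary.Unique.Propositional using (Unique)
import Data.List.Relation.Unary.Unique.Propositional.Properties as Unique
open import Data.Maybe using (Maybe; just; nothing; fromMaybe)
import Data.Maybe as Maybe
open import Data.Maybe.Properties using (just-injective)
open import Data.Nat using (ℕ; zero; suc; _+_; _∸_; _⊓_; _≤_; _<_; _≤?_; _<?_; z≤n; s≤s)
open import Data.Nat.Induction using (<-wellFounded)
open import Data.Nat.Properties
  using (≤-refl; ≤-reflexive; ≤-trans; ≤-antisym; ≤-pred; <-irrefl; <-asym; ≤-<-trans; <-≤-trans;
         <⇒≤; <⇒≱; ≮⇒≥; ≰⇒>; n≤1+n; 1+n≢n; suc-injective; m≤n⇒m<n∨m≡n; +-suc; +-mono-≤;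
         +-monoʳ-≤; +-mono-<-≤; +-mono-≤-<; m⊓n≤m; m⊓n≤n; ∸-monoʳ-≤; ∸-monoʳ-<; m+[n∸m]≡n;
         module ≤-Reasoning)
open import Data.Product using (Σ; _×_; _,_; proj₁; proj₂; ∃-syntax)
open import Data.Sum using (_⊎_; inj₁; inj₂; swap)
open import Data.Vec using ([]; _∷_; here; there; tabulate; foldr₁)
open import Data.Vec.Functional using (updateAt)
open import Data.Vec.Functional.Properties using (updateAt-updates; updateAt-minimal)
open import Data.Vec.Properties using (lookup∘tabulate; lookup⇒[]=; []=⇒lookup)
open import Function using (_∘_; case_of_; _⇔_; mk⇔; Equivalence)
open import Induction.WellFounded using (Acc; acc)
open import Relation.Binary.PropositionalEquality using (_≡_; _≢_; refl; sym; trans; cong; subst)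
open import Relation.Nullary using (¬_; Dec; yes; no)
open import Relation.Nullary.Decidable using (_×-dec_; _→-dec_; ¬?; decidable-stable)

module _ {A : Set} where

  nth : List A → ℕ → Maybe A
  nth []       _       = nothing
  nth (x ∷ xs) zero    = just x
  nth (x ∷ xs) (suc a) = nth xs a

  nth-lookup : ∀ xs (i : Fin (length xs)) → nth xs (toℕ i) ≡ just (lookup xs i)
  nth-lookup (x ∷ xs) fzero    = refl
  nth-lookup (x ∷ xs) (fsuc i) = nth-lookup xs i

  nth⇒lookup : ∀ xs a {w} → nth xs a ≡ just w → ∃[ i ] (toℕ i ≡ a × lookup xs i ≡ w)
  nth⇒lookup (x ∷ xs) zero    refl = fzero , refl , refl
  nth⇒lookup (x ∷ xs) (suc a) e with nth⇒lookup xs a e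
  ... | i , refl , refl = fsuc i , refl , refl

  nth⇒< : ∀ xs a {w} → nth xs a ≡ just w → a < length xs
  nth⇒< (x ∷ xs) zero    _ = s≤s z≤n
  nth⇒< (x ∷ xs) (suc a) e = s≤s (nth⇒< xs a e)

  <⇒nth : ∀ xs a → a < length xs → ∃[ w ] nth xs a ≡ just w
  <⇒nth (x ∷ xs) zero    _       = x , refl
  <⇒nth (x ∷ xs) (suc a) (s≤s p) = <⇒nth xs a p

  ∈⇒nth : ∀ {xs w} → w ∈ₗ xs → ∃[ a ] nth xs a ≡ just w
  ∈⇒nth (here refl) = zero , refl
  ∈⇒nth (there p) with ∈⇒nth p
  ... | a , e = suc a , e

  nth⇒∈ : ∀ xs a {w} → nth xs a ≡ just w → w ∈ₗ xs
  nth⇒∈ (x ∷ xs) zero    refl = here refl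
  nth⇒∈ (x ∷ xs) (suc a) e    = there (nth⇒∈ xs a e)

  nth⇒∈-drop : ∀ xs a b {w} → nth xs a ≡ just w → b ≤ a → w ∈ₗ drop b xs
  nth⇒∈-drop xs       a       zero    e _       = nth⇒∈ xs a e
  nth⇒∈-drop (x ∷ xs) (suc a) (suc b) e (s≤s p) = nth⇒∈-drop xs a b e p

  ∈-drop⇒nth : ∀ xs b {w} → w ∈ₗ drop b xs → ∃[ a ] (b ≤ a × nth xs a ≡ just w)
  ∈-drop⇒nth xs zero p with ∈⇒nth p
  ... | a , e = a , z≤n , e
  ∈-drop⇒nth (x ∷ xs) (suc b) p with ∈-drop⇒nth xs b p
  ... | a , b≤a , e = suc a , s≤s b≤a , e

  ∈-drop⇒< : ∀ xs b {w} → w ∈ₗ drop b xs → b < length xs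
  ∈-drop⇒< xs b w∈ with ∈-drop⇒nth xs b w∈
  ... | a , b≤a , e = ≤-<-trans b≤a (nth⇒< xs a e)

  nth-++ˡ : ∀ xs ys a → a < length xs → nth (xs ++ ys) a ≡ nth xs a
  nth-++ˡ (x ∷ xs) ys zero    _       = refl
  nth-++ˡ (x ∷ xs) ys (suc a) (s≤s p) = nth-++ˡ xs ys a p

  nth-∷ʳ-length : ∀ xs v → nth (xs ∷ʳ v) (length xs) ≡ just v
  nth-∷ʳ-length []       v = refl
  nth-∷ʳ-length (x ∷ xs) v = nth-∷ʳ-length xs v

  nth-∷ʳ⁻ : ∀ xs v a {w} → nth (xs ∷ʳ v) a ≡ just w →
            (a < length xs × nth xs a ≡ just w) ⊎ (a ≡ length xs × w ≡ v)
  nth-∷ʳ⁻ []       v zero    refl = inj₂ (refl , refl)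
  nth-∷ʳ⁻ (x ∷ xs) v zero    e    = inj₁ (s≤s z≤n , e)
  nth-∷ʳ⁻ (x ∷ xs) v (suc a) e with nth-∷ʳ⁻ xs v a e
  ... | inj₁ (a<n , e′) = inj₁ (s≤s a<n , e′)
  ... | inj₂ (a≡n , w≡v) = inj₂ (cong suc a≡n , w≡v)

  length-∷ʳ : ∀ xs (v : A) → length (xs ∷ʳ v) ≡ suc (length xs)
  length-∷ʳ []       v = refl
  length-∷ʳ (x ∷ xs) v = cong suc (length-∷ʳ xs v)

Unique-∷ʳ : ∀ {A : Set} {xs : List A} {v} → Unique xs → ¬ v ∈ₗ xs → Unique (xs ∷ʳ v)
Unique-∷ʳ unique v∉xs = Unique.++⁺ unique ([] ∷ []) λ { (v∈xs , here refl) → v∉xs v∈xs }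

just? : (m : Maybe ℕ) → Dec (∃[ j ] m ≡ just j)
just? nothing  = no λ { (_ , ()) }
just? (just j) = yes (j , refl)

Maybe-fromℕ< : ∀ (m : Maybe ℕ) L → (∀ j → m ≡ just j → j < L) →
               Σ (Maybe (Fin L)) λ r → Maybe.map toℕ r ≡ m
Maybe-fromℕ< nothing  L _     = nothing , refl
Maybe-fromℕ< (just j) L j<L = just (fromℕ< (j<L j refl)) , cong just (toℕ-fromℕ< _)

updateAt-elim : ∀ {A : Set} {m} (P : Fin m → A → Set) (xs : Fin m → A) i (f : A → A) →
                P i (f (xs i)) → (∀ j → j ≢ i → P j (xs j)) → ∀ j → P j (updateAt xs i f j)
updateAt-elim P xs i f Pi Pothers j with j ≟ i
... | yes refl = subst (P i) (sym (updateAt-updates i xs)) Pi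
... | no  j≢i  = subst (P j) (sym (updateAt-minimal j i xs j≢i)) (Pothers j j≢i)

∑ : ∀ {m} → (Fin m → ℕ) → ℕ
∑ {zero}  f = 0
∑ {suc m} f = f fzero + ∑ (λ i → f (fsuc i))

∑-mono-≤ : ∀ {m} {f g : Fin m → ℕ} → (∀ i → f i ≤ g i) → ∑ f ≤ ∑ g
∑-mono-≤ {zero}  f≤g = z≤n
∑-mono-≤ {suc m} f≤g = +-mono-≤ (f≤g fzero) (∑-mono-≤ (λ i → f≤g (fsuc i)))

∑-mono-< : ∀ {m} {f g : Fin m → ℕ} → (∀ i → f i ≤ g i) → ∀ i → f i < g i → ∑ f < ∑ g
∑-mono-< f≤g fzero    lt = +-mono-<-≤ lt (∑-mono-≤ (λ i → f≤g (fsuc i)))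
∑-mono-< f≤g (fsuc i) lt = +-mono-≤-< (f≤g fzero) (∑-mono-< (λ j → f≤g (fsuc j)) i lt)

module _ {State : Set} (Inv Done : State → Set) (μ : State → ℕ)
         (step : ∀ s → Inv s → Done s ⊎ Σ State λ s′ → Inv s′ × μ s′ < μ s) where

  iterate : ∀ s → Inv s → Σ State λ s′ → Inv s′ × Done s′
  iterate s inv = go s inv (<-wellFounded (μ s))
    where
    go : ∀ s → Inv s → Acc _<_ (μ s) → Σ State λ s′ → Inv s′ × Done s′
    go s inv (acc rs) with step s inv
    ... | inj₁ done               = s , inv , done
    ... | inj₂ (s′ , inv′ , s′<s) = go s′ inv′ (rs s′<s)

∣p∣≤1+∣p-x∣ : ∀ {n} (p : Subset n) x → ∣ p ∣ ≤ suc ∣ p - x ∣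
∣p∣≤1+∣p-x∣ (inside  ∷ p) fzero    = subst (λ q → suc ∣ p ∣ ≤ suc ∣ q ∣) (sym (p─⊥≡p p)) ≤-refl
∣p∣≤1+∣p-x∣ (outside ∷ p) fzero    = subst (λ q → ∣ p ∣ ≤ suc ∣ q ∣) (sym (p─⊥≡p p)) (n≤1+n _)
∣p∣≤1+∣p-x∣ (inside  ∷ p) (fsuc x) = s≤s (∣p∣≤1+∣p-x∣ p x)
∣p∣≤1+∣p-x∣ (outside ∷ p) (fsuc x) = ∣p∣≤1+∣p-x∣ p x

full⇒n≤∣p∣ : ∀ {n} {p : Subset n} → (∀ v → v ∈ p) → n ≤ ∣ p ∣
full⇒n≤∣p∣ {n} {p} full = subst (_≤ ∣ p ∣) (∣⊤∣≡n n) (p⊆q⇒∣p∣≤∣q∣ {p = ⊤} (λ {v} _ → full v))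

∣p∪q∣≤∣p∣+∣q∣ : ∀ {n} (p q : Subset n) → ∣ p ∪ q ∣ ≤ ∣ p ∣ + ∣ q ∣
∣p∪q∣≤∣p∣+∣q∣ []            []            = z≤n
∣p∪q∣≤∣p∣+∣q∣ (inside  ∷ p) (inside  ∷ q) = s≤s (≤-trans (∣p∪q∣≤∣p∣+∣q∣ p q) (+-monoʳ-≤ ∣ p ∣ (n≤1+n _)))
∣p∪q∣≤∣p∣+∣q∣ (inside  ∷ p) (outside ∷ q) = s≤s (∣p∪q∣≤∣p∣+∣q∣ p q)
∣p∪q∣≤∣p∣+∣q∣ (outside ∷ p) (inside  ∷ q) = ≤-trans (s≤s (∣p∪q∣≤∣p∣+∣q∣ p q)) (≤-reflexive (sym (+-suc _ _)))
∣p∪q∣≤∣p∣+∣q∣ (outside ∷ p) (outside ∷ q) = ∣p∪q∣≤∣p∣+∣q∣ p q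

x∈p-y⇒x≢y : ∀ {n} (p : Subset n) {x} y → x ∈ p - y → x ≢ y
x∈p-y⇒x≢y (s ∷ p) fzero    (there _) ()
x∈p-y⇒x≢y (s ∷ p) (fsuc y) here      ()
x∈p-y⇒x≢y (s ∷ p) (fsuc y) (there q) e = x∈p-y⇒x≢y p y q (fsuc-injective e)

full⊎missing : ∀ {n} (S : Subset n) → (∀ v → v ∈ S) ⊎ ∃[ v ] v ∉ S
full⊎missing {n} S with all? (_∈? S)
... | yes full = inj₁ full
... | no ¬full = inj₂ (¬∀⟶∃¬ n (_∈ S) (_∈? S) ¬full)

image : ∀ {m n} → (Fin m → Fin n) → Subset n
image {zero}  f = ⊥
image {suc m} f = ⁅ f fzero ⁆ ∪ image (λ i → f (fsuc i))

f[i]∈image : ∀ {m n} (f : Fin m → Fin n) i → f i ∈ image f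
f[i]∈image f fzero    = x∈p∪q⁺ (inj₁ (x∈⁅x⁆ (f fzero)))
f[i]∈image f (fsuc i) = x∈p∪q⁺ (inj₂ (f[i]∈image (λ j → f (fsuc j)) i))

∣image∣≤ : ∀ {m n} (f : Fin m → Fin n) → ∣ image f ∣ ≤ m
∣image∣≤ {zero}  {n} f = ≤-reflexive (∣⊥∣≡0 n)
∣image∣≤ {suc m}     f = ≤-trans (∣p∪q∣≤∣p∣+∣q∣ ⁅ f fzero ⁆ _)
                           (+-mono-≤ (≤-reflexive (∣⁅x⁆∣≡1 (f fzero))) (∣image∣≤ (λ i → f (fsuc i))))

superset-of-size : ∀ {n} (p : Subset n) t → ∣ p ∣ ≤ t → t ≤ n → ∃[ q ] (p ⊆ q × ∣ q ∣ ≡ t)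
superset-of-size []            zero    _       _       = [] , (λ ()) , refl
superset-of-size (inside  ∷ p) (suc t) (s≤s a) (s≤s b) with superset-of-size p t a b
... | q , p⊆q , ∣q∣≡t = inside ∷ q , s⊆s p⊆q , cong suc ∣q∣≡t
superset-of-size {suc n} (outside ∷ p) t a b with t ≤? n
... | yes t≤n with superset-of-size p t a t≤n
...   | q , p⊆q , ∣q∣≡t = outside ∷ q , s⊆s p⊆q , ∣q∣≡t
superset-of-size {suc n} (outside ∷ p) t a b | no t≰n with superset-of-size p n (∣p∣≤n p) ≤-refl
...   | q , p⊆q , ∣q∣≡n = inside ∷ q , out⊆ p⊆q , trans (cong suc ∣q∣≡n) (≤-antisym (≰⇒> t≰n) b)

enumerate : ∀ {n} (p : Subset n) → Fin ∣ p ∣ → Fin n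
enumerate (inside  ∷ p) fzero    = fzero
enumerate (inside  ∷ p) (fsuc i) = fsuc (enumerate p i)
enumerate (outside ∷ p) i        = fsuc (enumerate p i)

enumerate-∈ : ∀ {n} (p : Subset n) i → enumerate p i ∈ p
enumerate-∈ (inside  ∷ p) fzero    = here
enumerate-∈ (inside  ∷ p) (fsuc i) = there (enumerate-∈ p i)
enumerate-∈ (outside ∷ p) i        = there (enumerate-∈ p i)

enumerate-injective : ∀ {n} (p : Subset n) {i j} → enumerate p i ≡ enumerate p j → i ≡ j
enumerate-injective (inside  ∷ p) {fzero}  {fzero}  _ = refl
enumerate-injective (inside  ∷ p) {fsuc i} {fsuc j} e = cong fsuc (enumerate-injective p (fsuc-injective e))
enumerate-injective (outside ∷ p)                   e = enumerate-injective p (fsuc-injective e)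

enumerate-onto : ∀ {n} (p : Subset n) {z} → z ∈ p → ∃[ i ] enumerate p i ≡ z
enumerate-onto (inside  ∷ p) here      = fzero , refl
enumerate-onto (inside  ∷ p) (there q) with enumerate-onto p q
... | i , e = fsuc i , cong fsuc e
enumerate-onto (outside ∷ p) (there q) with enumerate-onto p q
... | i , e = i , cong fsuc e

module _ {n} (G : Graph n) where

  Adj-sym : ∀ {u v} → Adj G u v → Adj G v u
  Adj-sym {u} {v} = trans (Graph.sym G v u)

  Adj-irrefl : ∀ {v} → ¬ Adj G v v
  Adj-irrefl {v} a with trans (sym a) (irrefl G v)
  ... | ()

  Adj⇒≢ : ∀ {u v} → Adj G u v → u ≢ v
  Adj⇒≢ a refl = Adj-irrefl a

  Adj? : ∀ u v → Dec (Adj G u v)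
  Adj? u v = adj G u v ≟ᵇ true

  ∈nbhd⇒Adj : ∀ {u z} → z ∈ nbhd G u → Adj G u z
  ∈nbhd⇒Adj {u} {z} q = trans (sym (lookup∘tabulate (adj G u) z)) ([]=⇒lookup q)

  Adj⇒∈nbhd : ∀ {u z} → Adj G u z → z ∈ nbhd G u
  Adj⇒∈nbhd {u} {z} a = lookup⇒[]= z (nbhd G u) (trans (lookup∘tabulate (adj G u) z) a)

  degree<order : ∀ v → degree G v < n
  degree<order v = subst (degree G v <_) (∣⊤∣≡n n)
    (p⊂q⇒∣p∣<∣q∣ ((λ _ → ∈⊤) , v , ∈⊤ , λ v∈N[v] → Adj-irrefl (∈nbhd⇒Adj v∈N[v])))

  Blue-mono : ∀ {S S′} → S ⊆ S′ → ∀ {v} → Blue G S v → Blue G S′ v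
  Blue-mono S⊆S′ (initial v∈S)        = initial (S⊆S′ v∈S)
  Blue-mono S⊆S′ (force u-blue a rest) =
    force (Blue-mono S⊆S′ u-blue) a (λ w aw w≢v → Blue-mono S⊆S′ (rest w aw w≢v))

  record FirstForce (S : Subset n) (x v : Fin n) : Set where
    field
      forcer∈  : x ∈ S
      forced∉  : v ∉ S
      adjacent : Adj G x v
      others∈  : ∀ w → Adj G x w → w ≢ v → w ∈ S

  blue⇒∈⊎firstForce : ∀ {S v} → Blue G S v → v ∈ S ⊎ ∃[ x ] ∃[ v′ ] FirstForce S x v′
  blue⇒∈⊎firstForce (initial v∈S) = inj₁ v∈S
  blue⇒∈⊎firstForce {S} (force {u} {v} u-blue a rest) with blue⇒∈⊎firstForce u-blue
  ... | inj₂ ff  = inj₂ ff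
  ... | inj₁ u∈S with any? (λ w → Adj? u w ×-dec ¬? (w ≟ v) ×-dec ¬? (w ∈? S))
  ...   | yes (w , aw , w≢v , w∉S) with blue⇒∈⊎firstForce (rest w aw w≢v)
  ...     | inj₁ w∈S = ⊥-elim (w∉S w∈S)
  ...     | inj₂ ff  = inj₂ ff
  blue⇒∈⊎firstForce {S} (force {u} {v} u-blue a rest) | inj₁ u∈S | no none with v ∈? S
  ...     | yes v∈S = inj₁ v∈S
  ...     | no  v∉S =
    inj₂ (u , v , record { forcer∈ = u∈S ; forced∉ = v∉S ; adjacent = a ; others∈ = others∈ })
    where
    others∈ : ∀ w → Adj G u w → w ≢ v → w ∈ S
    others∈ w aw w≢v = decidable-stable (w ∈? S) (λ w∉S → none (w , aw , w≢v , w∉S))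

  missing⇒firstForce : ∀ {S v} → IsZeroForcingSet G S → v ∉ S → ∃[ x ] ∃[ v′ ] FirstForce S x v′
  missing⇒firstForce {v = v} zfs v∉S with blue⇒∈⊎firstForce (zfs v)
  ... | inj₁ v∈S = ⊥-elim (v∉S v∈S)
  ... | inj₂ ff  = ff

  module _ {S x v} (ff : FirstForce S x v) where
    open FirstForce ff

    N[x]-v⊆S-x : nbhd G x - v ⊆ S - x
    N[x]-v⊆S-x {z} z∈N-v =
      x∈p∧x≢y⇒x∈p-y (others∈ z (∈nbhd⇒Adj z∈N) z≢v) (λ z≡x → Adj⇒≢ (∈nbhd⇒Adj z∈N) (sym z≡x))
      where
      z∈N : z ∈ nbhd G x
      z∈N = p─q⊆p (nbhd G x) ⁅ v ⁆ z∈N-v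
      z≢v : z ≢ v
      z≢v = x∈p-y⇒x≢y (nbhd G x) v z∈N-v

    firstForce⇒degree≤ : degree G x ≤ ∣ S ∣
    firstForce⇒degree≤ = begin
      degree G x         ≤⟨ ∣p∣≤1+∣p-x∣ (nbhd G x) v ⟩
      suc ∣ nbhd G x - v ∣ ≤⟨ s≤s (p⊆q⇒∣p∣≤∣q∣ N[x]-v⊆S-x) ⟩
      suc ∣ S - x ∣        ≤⟨ x∈p⇒∣p-x∣<∣p∣ forcer∈ ⟩
      ∣ S ∣                ∎
      where open ≤-Reasoning

    -- A vertex of S outside N[x] would make the inclusion above strict.
    firstForce⇒⊆closedNbhd : ∣ S ∣ ≤ degree G x → ∀ s → s ∈ S → s ≡ x ⊎ Adj G x s
    firstForce⇒⊆closedNbhd ∣S∣≤deg s s∈S with s ≟ x | Adj? x s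
    ... | yes s≡x | _      = inj₁ s≡x
    ... | no _    | yes a  = inj₂ a
    ... | no s≢x  | no ¬a = ⊥-elim (<⇒≱ degree<∣S∣ ∣S∣≤deg)
      where
      N-v⊂S-x : nbhd G x - v ⊂ S - x
      N-v⊂S-x = N[x]-v⊆S-x , s , x∈p∧x≢y⇒x∈p-y s∈S s≢x ,
                λ s∈N-v → ¬a (∈nbhd⇒Adj (p─q⊆p (nbhd G x) ⁅ v ⁆ s∈N-v))
      degree<∣S∣ : degree G x < ∣ S ∣
      degree<∣S∣ = begin-strict
        degree G x           ≤⟨ ∣p∣≤1+∣p-x∣ (nbhd G x) v ⟩
        suc ∣ nbhd G x - v ∣ <⟨ s≤s (p⊂q⇒∣p∣<∣q∣ N-v⊂S-x) ⟩
        suc ∣ S - x ∣        ≤⟨ x∈p⇒∣p-x∣<∣p∣ forcer∈ ⟩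
        ∣ S ∣                ∎
        where open ≤-Reasoning

foldr₁-⊓-tabulate-≤ : ∀ {m} (f : Fin (suc m) → ℕ) i → foldr₁ _⊓_ (tabulate f) ≤ f i
foldr₁-⊓-tabulate-≤ {zero}  f fzero    = ≤-refl
foldr₁-⊓-tabulate-≤ {suc m} f fzero    = m⊓n≤m (f fzero) _
foldr₁-⊓-tabulate-≤ {suc m} f (fsuc i) =
  ≤-trans (m⊓n≤n (f fzero) _) (foldr₁-⊓-tabulate-≤ (λ j → f (fsuc j)) i)

module _ {n} (G : Graph (suc n)) where

  minDegree≤degree : ∀ v → minDegree G ≤ degree G v
  minDegree≤degree = foldr₁-⊓-tabulate-≤ (degree G)

  minDegree<order : minDegree G < suc n
  minDegree<order = ≤-<-trans (minDegree≤degree fzero) (degree<order G fzero)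

  minDegree≤∣zeroForcingSet∣ : ∀ {S} → IsZeroForcingSet G S → minDegree G ≤ ∣ S ∣
  minDegree≤∣zeroForcingSet∣ {S} zfs with full⊎missing S
  ... | inj₁ full = ≤-trans (minDegree≤degree fzero) (p⊆q⇒∣p∣≤∣q∣ {p = nbhd G fzero} (λ {z} _ → full z))
  ... | inj₂ (_ , v∉S) with missing⇒firstForce G zfs v∉S
  ...   | x , _ , ff = ≤-trans (minDegree≤degree x) (firstForce⇒degree≤ G ff)

-- Induced paths and the choice condition, by natural-number positions

Consecutive : ℕ → ℕ → Set
Consecutive a b = suc a ≡ b ⊎ suc b ≡ a

module _ {n} (G : Graph n) where

  -- Positions are natural numbers rather than Fin (length p), so that they survive
  -- appending to p.
  IsInducedPathᴺ : List (Fin n) → Set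
  IsInducedPathᴺ p = ∀ a b {u w} → nth p a ≡ just u → nth p b ≡ just w → Adj G u w ⇔ Consecutive a b

  isInducedPath⇒ᴺ : ∀ p → IsInducedPath G p → IsInducedPathᴺ p
  isInducedPath⇒ᴺ p (_ , adj⇔) a b pa pb with nth⇒lookup p a pa | nth⇒lookup p b pb
  ... | i , refl , refl | j , refl , refl = mk⇔ (proj₁ (adj⇔ i j)) (proj₂ (adj⇔ i j))

  ᴺ⇒isInducedPath : ∀ p → Unique p → IsInducedPathᴺ p → IsInducedPath G p
  ᴺ⇒isInducedPath p unique induced = unique , λ i j →
    let adj⇔ = induced (toℕ i) (toℕ j) (nth-lookup p i) (nth-lookup p j)
    in Equivalence.to adj⇔ , Equivalence.from adj⇔

  ExactlyOneNeighbourIn-transfer : ∀ {w} {Y Y′ : Fin n → Set} → ExactlyOneNeighbourIn G w Y →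
    (∀ z → Y z → Y′ z) → (∀ z → Y′ z → Adj G w z → Y z) → ExactlyOneNeighbourIn G w Y′
  ExactlyOneNeighbourIn-transfer (y , (y∈Y , a) , unique) Y⊆Y′ back =
    y , (Y⊆Y′ y y∈Y , a) , λ z z∈Y′ az → unique z (back z z∈Y′ az) az

  module _ {k} (Q : Fin k → List (Fin n)) where

    Beyond : (Fin k → Maybe ℕ) → Fin n → Set
    Beyond c v = ∃[ i ] ∃[ j ] (c i ≡ just j × v ∈ₗ drop (suc j) (Q i))

    ChosenWithUniqueNeighbour : (Fin k → Maybe ℕ) → Set
    ChosenWithUniqueNeighbour c =
      ∃[ i ] ∃[ j ] ∃[ w ] (c i ≡ just j × nth (Q i) j ≡ just w × ExactlyOneNeighbourIn G w (Beyond c))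

    ChoiceConditionᴺ : Set
    ChoiceConditionᴺ =
      ∀ (c : Fin k → Maybe ℕ) → (∃[ i ] ∃[ j ] c i ≡ just j) →
      (∀ i j → c i ≡ just j → suc j < length (Q i)) → ChosenWithUniqueNeighbour c

    FinChoice : Set
    FinChoice = (i : Fin k) → Maybe (Fin (length (Q i)))

    BeyondFin : FinChoice → Fin n → Set
    BeyondFin c v = ∃[ i ] ∃[ j ] (c i ≡ just j × v ∈ₗ drop (suc (toℕ j)) (Q i))

    ChosenWithUniqueNeighbourFin : FinChoice → Set
    ChosenWithUniqueNeighbourFin c = ∃[ i ] ∃[ j ] (c i ≡ just j × ExactlyOneNeighbourIn G (lookup (Q i) j) (BeyondFin c))

    ChoiceCondition : Set
    ChoiceCondition =
      ∀ (c : FinChoice) → (∃[ i ] ∃[ j ] (c i ≡ just j)) →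
      (∀ i j → c i ≡ just j → suc (toℕ j) < length (Q i)) → ChosenWithUniqueNeighbourFin c

    module Translation (c : FinChoice) (cᴺ : Fin k → Maybe ℕ) (c≗cᴺ : ∀ i → Maybe.map toℕ (c i) ≡ cᴺ i) where

      chosenᴺ⇒chosen : ∀ {i m} → cᴺ i ≡ just m → ∃[ j ] (c i ≡ just j × toℕ j ≡ m)
      chosenᴺ⇒chosen {i} ci≡m with c i | c≗cᴺ i
      ... | just j  | e = j , refl , just-injective (trans e ci≡m)
      ... | nothing | e with () ← trans e ci≡m

      chosen⇒chosenᴺ : ∀ {i j} → c i ≡ just j → cᴺ i ≡ just (toℕ j)
      chosen⇒chosenᴺ {i} ci≡j = trans (sym (c≗cᴺ i)) (cong (Maybe.map toℕ) ci≡j)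

      beyondFin⇒beyond : ∀ z → BeyondFin c z → Beyond cᴺ z
      beyondFin⇒beyond z (i , j , ci≡j , z∈) = i , toℕ j , chosen⇒chosenᴺ ci≡j , z∈

      beyond⇒beyondFin : ∀ z → Beyond cᴺ z → BeyondFin c z
      beyond⇒beyondFin z (i , m , ci≡m , z∈) with chosenᴺ⇒chosen ci≡m
      ... | j , ci≡j , refl = i , j , ci≡j , z∈

    choiceConditionᴺ⇒ : ChoiceConditionᴺ → ChoiceCondition
    choiceConditionᴺ⇒ condition c (i₀ , j₀ , ci₀≡j₀) valid = result (condition cᴺ chosenᴺ validᴺ)
      where
      cᴺ : Fin k → Maybe ℕ
      cᴺ i = Maybe.map toℕ (c i)
      open Translation c cᴺ (λ _ → refl)
      chosenᴺ : ∃[ i ] ∃[ m ] cᴺ i ≡ just m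
      chosenᴺ = i₀ , toℕ j₀ , chosen⇒chosenᴺ ci₀≡j₀
      validᴺ : ∀ i m → cᴺ i ≡ just m → suc m < length (Q i)
      validᴺ i m ci≡m with chosenᴺ⇒chosen ci≡m
      ... | j , ci≡j , refl = valid i j ci≡j
      result : ChosenWithUniqueNeighbour cᴺ → ChosenWithUniqueNeighbourFin c
      result (i , m , w , ci≡m , at , exactly) with chosenᴺ⇒chosen ci≡m
      ... | j , ci≡j , refl with refl ← just-injective (trans (sym at) (nth-lookup (Q i) j)) =
        i , j , ci≡j ,
        ExactlyOneNeighbourIn-transfer exactly beyond⇒beyondFin (λ z z∈ _ → beyondFin⇒beyond z z∈)

    choiceCondition⇒ᴺ : ChoiceCondition → ChoiceConditionᴺ
    choiceCondition⇒ᴺ condition cᴺ (i₀ , m₀ , ci₀≡m₀) validᴺ = result (condition c chosen valid)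
      where
      toFin : ∀ i → Σ (Maybe (Fin (length (Q i)))) λ r → Maybe.map toℕ r ≡ cᴺ i
      toFin i = Maybe-fromℕ< (cᴺ i) (length (Q i)) (λ j ci≡j → ≤-trans (n≤1+n _) (validᴺ i j ci≡j))
      c : FinChoice
      c i = proj₁ (toFin i)
      open Translation c cᴺ (λ i → proj₂ (toFin i))
      chosen : ∃[ i ] ∃[ j ] c i ≡ just j
      chosen with chosenᴺ⇒chosen ci₀≡m₀
      ... | j , ci₀≡j , _ = i₀ , j , ci₀≡j
      valid : ∀ i j → c i ≡ just j → suc (toℕ j) < length (Q i)
      valid i j ci≡j = validᴺ i (toℕ j) (chosen⇒chosenᴺ ci≡j)
      result : ChosenWithUniqueNeighbourFin c → ChosenWithUniqueNeighbour cᴺ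
      result (i , j , ci≡j , exactly) =
        i , toℕ j , lookup (Q i) j , chosen⇒chosenᴺ ci≡j , nth-lookup (Q i) j ,
        ExactlyOneNeighbourIn-transfer exactly beyondFin⇒beyond (λ z z∈ _ → beyond⇒beyondFin z z∈)

module _ {n} (G : Graph n) (p : List (Fin n)) {v} (induced : IsInducedPathᴺ G p)
         (v-after-last : ∀ a {w} → nth p a ≡ just w → Adj G w v ⇔ suc a ≡ length p) where

  private
    adjacent-to-new : ∀ {a w} → a < length p → nth p a ≡ just w → Adj G w v ⇔ Consecutive a (length p)
    adjacent-to-new {a} a<n pa = mk⇔ (inj₁ ∘ Equivalence.to (v-after-last a pa)) λ where
      (inj₁ sa≡n) → Equivalence.from (v-after-last a pa) sa≡n
      (inj₂ sn≡a) → ⊥-elim (<-asym a<n (≤-reflexive sn≡a))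

  IsInducedPathᴺ-∷ʳ : IsInducedPathᴺ G (p ∷ʳ v)
  IsInducedPathᴺ-∷ʳ a b pa pb with nth-∷ʳ⁻ p v a pa | nth-∷ʳ⁻ p v b pb
  ... | inj₁ (_ , pa′)     | inj₁ (_ , pb′)     = induced a b pa′ pb′
  ... | inj₁ (a<n , pa′)   | inj₂ (refl , refl) = adjacent-to-new a<n pa′
  ... | inj₂ (refl , refl) | inj₁ (b<n , pb′)   =
    mk⇔ (swap ∘ Equivalence.to (adjacent-to-new b<n pb′) ∘ Adj-sym G)
        (Adj-sym G ∘ Equivalence.from (adjacent-to-new b<n pb′) ∘ swap)
  ... | inj₂ (refl , refl) | inj₂ (refl , refl) =
    mk⇔ (⊥-elim ∘ Adj-irrefl G) λ where
      (inj₁ sn≡n) → ⊥-elim (1+n≢n sn≡n)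
      (inj₂ sn≡n) → ⊥-elim (1+n≢n sn≡n)

-- Internally parallel paths give a zero forcing set

module ForcingAlongParallelPaths {n} (G : Graph n) {k} (x : Fin n) (Q : Fin (suc k) → List (Fin n))
  (induced : ∀ i → IsInducedPathᴺ G (x ∷ Q i)) (covers : ∀ v → ∃[ i ] v ∈ₗ (x ∷ Q i))
  (choice : ChoiceConditionᴺ G Q) where

  start : Fin (suc k) → Fin n
  start fzero    = x
  start (fsuc i) = fromMaybe x (head (Q (fsuc i)))

  S₀ : Subset n
  S₀ = image start

  B : Fin n → Set
  B = Blue G S₀

  position : ∀ w → w ≡ x ⊎ ∃[ i ] ∃[ a ] nth (Q i) a ≡ just w
  position w with covers w
  ... | i , here w≡x = inj₁ w≡x
  ... | i , there w∈ = inj₂ (i , ∈⇒nth w∈)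

  first∈S₀ : ∀ i {w} → nth (Q (fsuc i)) 0 ≡ just w → w ∈ S₀
  first∈S₀ i e with Q (fsuc i) | f[i]∈image start (fsuc i)
  ... | h ∷ _ | h∈S₀ with refl ← e = h∈S₀

  adjacent-to-x⇒first : ∀ {w} → Adj G x w → ∃[ i ] nth (Q i) 0 ≡ just w
  adjacent-to-x⇒first {w} a with position w
  ... | inj₁ refl = ⊥-elim (Adj-irrefl G a)
  ... | inj₂ (i , pos , e) with Equivalence.to (induced i 0 (suc pos) refl e) a
  ...   | inj₁ refl = i , e

  first-of-Q₀-blue : ∀ {h} → nth (Q fzero) 0 ≡ just h → B h
  first-of-Q₀-blue {h} e =
    force (initial (f[i]∈image start fzero)) (Equivalence.from (induced fzero 0 1 refl e) (inj₁ refl)) others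
    where
    others : ∀ w → Adj G x w → w ≢ h → B w
    others w a w≢h with adjacent-to-x⇒first a
    ... | fzero  , e′ = ⊥-elim (w≢h (just-injective (trans (sym e′) e)))
    ... | fsuc i , e′ = initial (first∈S₀ i e′)

  Unfinished : (Fin (suc k) → ℕ) → Fin (suc k) → Set
  Unfinished p i = p i < length (Q i)

  record BluePrefixes (p : Fin (suc k) → ℕ) : Set where
    field
      blue    : ∀ i a {w} → a < p i → nth (Q i) a ≡ just w → B w
      bounded : ∀ i → p i ≤ length (Q i)
      started : ∀ i → Unfinished p i → 0 < p i

  module Advance {p} (prefixes : BluePrefixes p) where
    open BluePrefixes prefixes

    -- Choose the last blue vertex of every unfinished path.
    frontier : Fin (suc k) → Maybe ℕ
    frontier i with p i <? length (Q i)
    ... | yes _ = just (p i ∸ 1)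
    ... | no  _ = nothing

    frontier-unfinished : ∀ i → Unfinished p i → frontier i ≡ just (p i ∸ 1)
    frontier-unfinished i unfinished with p i <? length (Q i)
    ... | yes _          = refl
    ... | no  finished = ⊥-elim (finished unfinished)

    frontier⁻ : ∀ i {j} → frontier i ≡ just j → Unfinished p i × suc j ≡ p i
    frontier⁻ i e with p i <? length (Q i)
    frontier⁻ i refl | yes unfinished = unfinished , m+[n∸m]≡n (started i unfinished)

    beyond-frontier : ∀ i a {w} → p i ≤ a → nth (Q i) a ≡ just w → Beyond G Q frontier w
    beyond-frontier i a p≤a e =
      i , p i ∸ 1 , frontier-unfinished i unfinished ,
      nth⇒∈-drop (Q i) a (suc (p i ∸ 1)) e (subst (_≤ a) (sym (m+[n∸m]≡n (started i unfinished))) p≤a)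
      where
      unfinished : Unfinished p i
      unfinished = ≤-<-trans p≤a (nth⇒< (Q i) a e)

    next-blue : ∃[ i ] Unfinished p i → ∃[ i ] ∃[ w ] (Unfinished p i × nth (Q i) (p i) ≡ just w × B w)
    next-blue (i₀ , unfinished₀) with choice frontier (i₀ , _ , frontier-unfinished i₀ unfinished₀) valid
      where
      valid : ∀ i j → frontier i ≡ just j → suc j < length (Q i)
      valid i j e with frontier⁻ i e
      ... | unfinished , sj≡p = subst (_< length (Q i)) (sym sj≡p) unfinished
    ... | i , j , u , fi≡j , at-j , y , _ , only-y with frontier⁻ i fi≡j
    ...   | unfinished , sj≡p with <⇒nth (Q i) (p i) unfinished
    ...     | y′ , at-p = i , y′ , unfinished , at-p , force u-blue u~y′ others
      where
      u-blue : B u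
      u-blue = blue i j (≤-reflexive sj≡p) at-j
      u~y′ : Adj G u y′
      u~y′ = Equivalence.from (induced i (suc j) (suc (p i)) at-j at-p) (inj₁ (cong suc sj≡p))
      y′-beyond : Beyond G Q frontier y′
      y′-beyond = beyond-frontier i (p i) ≤-refl at-p
      -- y′ is the only neighbour of u beyond the frontier; the others lie in blue prefixes.
      others : ∀ w → Adj G u w → w ≢ y′ → B w
      others w a w≢y′ with position w
      ... | inj₁ refl = initial (f[i]∈image start fzero)
      ... | inj₂ (i′ , b , e) with b <? p i′
      ...   | yes b<p = blue i′ b b<p e
      ...   | no  b≮p = ⊥-elim (w≢y′ (trans (only-y w (beyond-frontier i′ b (≮⇒≥ b≮p) e) a)
                                          (sym (only-y y′ y′-beyond u~y′))))

  μ : (Fin (suc k) → ℕ) → ℕ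
  μ p = ∑ (λ i → length (Q i) ∸ p i)

  extend : ∀ {p} → BluePrefixes p → ∀ i {w} → Unfinished p i → nth (Q i) (p i) ≡ just w → B w →
           BluePrefixes (updateAt p i suc) × μ (updateAt p i suc) < μ p
  extend {p} prefixes i unfinished at-p w-blue = prefixes′ , ∑-mono-< shorter i strictly-shorter
    where
    open BluePrefixes prefixes
    blue-i : ∀ a {v} → a < suc (p i) → nth (Q i) a ≡ just v → B v
    blue-i a a<sp e with m≤n⇒m<n∨m≡n (≤-pred a<sp)
    ... | inj₁ a<p  = blue i a a<p e
    ... | inj₂ refl = subst B (just-injective (trans (sym at-p) e)) w-blue
    prefixes′ : BluePrefixes (updateAt p i suc)
    prefixes′ = record
      { blue    = updateAt-elim (λ i′ q → ∀ a {v} → a < q → nth (Q i′) a ≡ just v → B v) p i suc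
                    blue-i (λ i′ _ → blue i′)
      ; bounded = updateAt-elim (λ i′ q → q ≤ length (Q i′)) p i suc unfinished (λ i′ _ → bounded i′)
      ; started = updateAt-elim (λ i′ q → q < length (Q i′) → 0 < q) p i suc
                    (λ _ → s≤s z≤n) (λ i′ _ → started i′)
      }
    shorter : ∀ i′ → length (Q i′) ∸ updateAt p i suc i′ ≤ length (Q i′) ∸ p i′
    shorter = updateAt-elim (λ i′ q → length (Q i′) ∸ q ≤ length (Q i′) ∸ p i′) p i suc
                (∸-monoʳ-≤ (length (Q i)) (n≤1+n (p i))) (λ _ _ → ≤-refl)
    strictly-shorter : length (Q i) ∸ updateAt p i suc i < length (Q i) ∸ p i
    strictly-shorter rewrite updateAt-updates i {suc} p = ∸-monoʳ-< ≤-refl unfinished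

  Finished : (Fin (suc k) → ℕ) → Set
  Finished p = ∀ i → ¬ Unfinished p i

  step : ∀ p → BluePrefixes p → Finished p ⊎ Σ _ λ p′ → BluePrefixes p′ × μ p′ < μ p
  step p prefixes with any? (λ i → p i <? length (Q i))
  ... | no none = inj₁ (λ i unfinished → none (i , unfinished))
  ... | yes unfinished with Advance.next-blue prefixes unfinished
  ...   | i , w , unfinished-i , at-p , w-blue =
    inj₂ (updateAt p i suc , extend prefixes i unfinished-i at-p w-blue)

  prefixes₀ : BluePrefixes (λ i → 1 ⊓ length (Q i))
  prefixes₀ = record
    { blue    = blue₀
    ; bounded = λ i → m⊓n≤n 1 (length (Q i))
    ; started = λ i unfinished → ≤-reflexive (sym (nonempty (Q i) (≤-<-trans z≤n unfinished)))
    }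
    where
    nonempty : ∀ (xs : List (Fin n)) → 0 < length xs → 1 ⊓ length xs ≡ 1
    nonempty (_ ∷ _) _ = refl
    blue₀ : ∀ i a {w} → a < 1 ⊓ length (Q i) → nth (Q i) a ≡ just w → B w
    blue₀ i a a<1 e with ≤-trans a<1 (m⊓n≤m 1 _)
    blue₀ fzero    zero _ e | s≤s z≤n = first-of-Q₀-blue e
    blue₀ (fsuc i) zero _ e | s≤s z≤n = initial (first∈S₀ i e)

  S₀-forces : IsZeroForcingSet G S₀
  S₀-forces v with iterate BluePrefixes Finished μ step _ prefixes₀ | position v
  ... | _         | inj₁ refl         = initial (f[i]∈image start fzero)
  ... | p , prefixes , finished | inj₂ (i , a , e) =
    BluePrefixes.blue prefixes i a (<-≤-trans (nth⇒< (Q i) a e) (≮⇒≥ (finished i))) e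

internallyParallelPaths⇒zeroForcingSet : ∀ {n} (G : Graph n) k → IsGraphOfInternallyParallelPaths G k →
                                          ∃[ S ] (IsZeroForcingSet G S × ∣ S ∣ ≤ k)
internallyParallelPaths⇒zeroForcingSet G zero (x , Q , _ , _ , covers , _) with covers x
... | () , _
internallyParallelPaths⇒zeroForcingSet G (suc k) (x , Q , induced , _ , covers , choice) =
  S₀ , S₀-forces , ∣image∣≤ start
  where
  open ForcingAlongParallelPaths G x Q (λ i → isInducedPath⇒ᴺ G (x ∷ Q i) (induced i)) covers
         (choiceCondition⇒ᴺ G Q choice)

-- Forcing chains of a zero forcing set of size δ are internally parallel paths

module FromZeroForcingSet {n} (G : Graph n) {S} (zfs : IsZeroForcingSet G S) (x : Fin n) {k}
  (nb : Fin k → Fin n) (nb-adjacent : ∀ i → Adj G x (nb i))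
  (nb-injective : ∀ {i j} → nb i ≡ nb j → i ≡ j) (nb-onto : ∀ {z} → Adj G x z → ∃[ i ] nb i ≡ z)
  (S⊆N[x] : ∀ s → s ∈ S → s ≡ x ⊎ Adj G x s) (i₁ : Fin k) where

  open import Data.List.Membership.DecPropositional (_≟_ {n}) using () renaming (_∈?_ to _∈ₗ?_)

  Chains : Set
  Chains = Fin k → List (Fin n)

  Covered : Chains → Fin n → Set
  Covered Q z = ∃[ i ] z ∈ₗ (x ∷ Q i)

  covered? : ∀ Q z → Dec (Covered Q z)
  covered? Q z = any? (λ i → z ∈ₗ? (x ∷ Q i))

  -- Q i is the forcing chain starting at the i-th neighbour of x, and the covered vertices
  -- are those coloured so far.  Every vertex of x ∷ Q i except the last has already
  -- forced, so all its neighbours are covered.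
  record ForcingChains (Q : Chains) : Set where
    field
      unique    : ∀ i → Unique (x ∷ Q i)
      induced   : ∀ i → IsInducedPathᴺ G (x ∷ Q i)
      disjoint  : ∀ i j → i ≢ j → ∀ z → z ∈ₗ Q i → ¬ z ∈ₗ Q j
      nonempty  : ∀ i → 0 < length (Q i)
      saturated : ∀ i a {w} → nth (x ∷ Q i) a ≡ just w → suc a < length (x ∷ Q i) →
                  ∀ z → Adj G w z → Covered Q z
      choice    : ChoiceConditionᴺ G Q
      S-covered : ∀ s → s ∈ S → Covered Q s

  Force : Chains → Fin n → Fin n → Set
  Force Q u v = Covered Q u × Adj G u v × ¬ Covered Q v × (∀ w → Adj G u w → w ≢ v → Covered Q w)

  force? : ∀ Q → Dec (∃[ u ] ∃[ v ] Force Q u v)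
  force? Q = any? λ u → any? λ v → covered? Q u ×-dec Adj? G u v ×-dec ¬? (covered? Q v) ×-dec
               all? λ w → Adj? G u w →-dec ¬? (w ≟ v) →-dec covered? Q w

  no-force⇒all-covered : ∀ {Q} → ForcingChains Q → ¬ (∃[ u ] ∃[ v ] Force Q u v) → ∀ v → Covered Q v
  no-force⇒all-covered {Q} chains no-force v = covered (zfs v)
    where
    covered : ∀ {v} → Blue G S v → Covered Q v
    covered (initial v∈S) = ForcingChains.S-covered chains _ v∈S
    covered (force {u} {v} u-blue u~v rest) with covered? Q v
    ... | yes v-covered = v-covered
    ... | no  v-uncovered =
      ⊥-elim (no-force (u , v , covered u-blue , u~v , v-uncovered , λ w u~w w≢v → covered (rest w u~w w≢v)))

  uncovered : Chains → Fin n → ℕ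
  uncovered Q z with covered? Q z
  ... | yes _ = 0
  ... | no  _ = 1

  μ : Chains → ℕ
  μ Q = ∑ (uncovered Q)

  forcer-terminal : ∀ {Q u v} → ForcingChains Q → Force Q u v →
                    ∃[ i₀ ] ∃[ a₀ ] (nth (Q i₀) a₀ ≡ just u × suc a₀ ≡ length (Q i₀))
  forcer-terminal {Q} {u} chains ((i , u∈) , u~v , v-uncovered , _) with ∈⇒nth u∈
  ... | a , e with suc a <? length (x ∷ Q i)
  ...   | yes interior = ⊥-elim (v-uncovered (ForcingChains.saturated chains i a e interior _ u~v))
  ...   | no ¬interior = terminal a e (≤-antisym (nth⇒< (x ∷ Q i) a e) (≮⇒≥ ¬interior))
    where
    terminal : ∀ a → nth (x ∷ Q i) a ≡ just u → suc a ≡ length (x ∷ Q i) →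
               ∃[ i₀ ] ∃[ a₀ ] (nth (Q i₀) a₀ ≡ just u × suc a₀ ≡ length (Q i₀))
    terminal zero     _ 1≡len = ⊥-elim (<-irrefl (suc-injective 1≡len) (ForcingChains.nonempty chains i))
    terminal (suc a₀) e last  = i , a₀ , e , suc-injective last

  module Extend {Q} (chains : ForcingChains Q) {u v} (u~v : Adj G u v) (v-uncovered : ¬ Covered Q v)
    (others-covered : ∀ w → Adj G u w → w ≢ v → Covered Q w)
    {i₀ a₀} (u-at : nth (Q i₀) a₀ ≡ just u) (u-last : suc a₀ ≡ length (Q i₀)) where
    open ForcingChains chains

    Q′ : Chains
    Q′ = updateAt Q i₀ (_∷ʳ v)

    ¬adjacent-interior : ∀ i a {w} → nth (x ∷ Q i) a ≡ just w → suc a < length (x ∷ Q i) → ¬ Adj G w v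
    ¬adjacent-interior i a e interior w~v = v-uncovered (saturated i a e interior v w~v)

    at-last⇒u : ∀ a {w} → nth (x ∷ Q i₀) a ≡ just w → suc a ≡ length (x ∷ Q i₀) → w ≡ u
    at-last⇒u a e last with refl ← suc-injective (trans last (cong suc (sym u-last))) =
      just-injective (trans (sym e) u-at)

    prefix : ∀ i a {w} → nth (x ∷ Q i) a ≡ just w → nth (x ∷ Q′ i) a ≡ just w
    prefix = updateAt-elim (λ i L → ∀ a {w} → nth (x ∷ Q i) a ≡ just w → nth (x ∷ L) a ≡ just w) Q i₀ (_∷ʳ v)
               (λ a e → trans (nth-++ˡ (x ∷ Q i₀) [ v ] a (nth⇒< (x ∷ Q i₀) a e)) e) (λ _ _ _ e → e)

    prefix⁻ : ∀ i a {w} → nth (x ∷ Q′ i) a ≡ just w →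
              nth (x ∷ Q i) a ≡ just w ⊎ (i ≡ i₀ × a ≡ length (x ∷ Q i₀) × w ≡ v)
    prefix⁻ = updateAt-elim (λ i L → ∀ a {w} → nth (x ∷ L) a ≡ just w →
                                      nth (x ∷ Q i) a ≡ just w ⊎ (i ≡ i₀ × a ≡ length (x ∷ Q i₀) × w ≡ v))
                Q i₀ (_∷ʳ v) new-i₀ (λ _ _ _ e → inj₁ e)
      where
      new-i₀ : ∀ a {w} → nth ((x ∷ Q i₀) ∷ʳ v) a ≡ just w →
               nth (x ∷ Q i₀) a ≡ just w ⊎ (i₀ ≡ i₀ × a ≡ length (x ∷ Q i₀) × w ≡ v)
      new-i₀ a e with nth-∷ʳ⁻ (x ∷ Q i₀) v a e
      ... | inj₁ (_ , e′)      = inj₁ e′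
      ... | inj₂ (a≡n , w≡v) = inj₂ (refl , a≡n , w≡v)

    v-at-end : nth (x ∷ Q′ i₀) (length (x ∷ Q i₀)) ≡ just v
    v-at-end rewrite updateAt-updates i₀ {_∷ʳ v} Q = nth-∷ʳ-length (x ∷ Q i₀) v

    drop-Q⊆Q′ : ∀ i b {z} → z ∈ₗ drop b (x ∷ Q i) → z ∈ₗ drop b (x ∷ Q′ i)
    drop-Q⊆Q′ i b z∈ with ∈-drop⇒nth (x ∷ Q i) b z∈
    ... | a , b≤a , e = nth⇒∈-drop (x ∷ Q′ i) a b (prefix i a e) b≤a

    drop-Q′⁻ : ∀ i b {z} → z ∈ₗ drop b (x ∷ Q′ i) → z ∈ₗ drop b (x ∷ Q i) ⊎ (i ≡ i₀ × z ≡ v)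
    drop-Q′⁻ i b z∈ with ∈-drop⇒nth (x ∷ Q′ i) b z∈
    ... | a , b≤a , e with prefix⁻ i a e
    ...   | inj₁ e′               = inj₁ (nth⇒∈-drop (x ∷ Q i) a b e′ b≤a)
    ...   | inj₂ (i≡i₀ , _ , z≡v) = inj₂ (i≡i₀ , z≡v)

    covered-mono : ∀ {z} → Covered Q z → Covered Q′ z
    covered-mono (i , z∈) = i , drop-Q⊆Q′ i 0 z∈

    v-covered : Covered Q′ v
    v-covered = i₀ , nth⇒∈ (x ∷ Q′ i₀) (length (x ∷ Q i₀)) v-at-end

    v-after-u : ∀ a {w} → nth (x ∷ Q i₀) a ≡ just w → Adj G w v ⇔ suc a ≡ length (x ∷ Q i₀)
    v-after-u a e = mk⇔ last-if-adjacent (λ last → subst (λ w → Adj G w v) (sym (at-last⇒u a e last)) u~v)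
      where
      last-if-adjacent : Adj G _ v → suc a ≡ length (x ∷ Q i₀)
      last-if-adjacent w~v with suc a <? length (x ∷ Q i₀)
      ... | yes interior  = ⊥-elim (¬adjacent-interior i₀ a e interior w~v)
      ... | no ¬interior = ≤-antisym (nth⇒< (x ∷ Q i₀) a e) (≮⇒≥ ¬interior)

    saturated-i₀ : ∀ a {w} → nth ((x ∷ Q i₀) ∷ʳ v) a ≡ just w → suc a < length ((x ∷ Q i₀) ∷ʳ v) →
                   ∀ z → Adj G w z → Covered Q′ z
    saturated-i₀ a e interior z w~z with nth-∷ʳ⁻ (x ∷ Q i₀) v a e
    ... | inj₂ (refl , _) = ⊥-elim (<-irrefl refl (≤-trans interior (≤-reflexive (length-∷ʳ (x ∷ Q i₀) v))))
    ... | inj₁ (a<n , e′) with suc a <? length (x ∷ Q i₀)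
    ...   | yes interior′ = covered-mono (saturated i₀ a e′ interior′ z w~z)
    ...   | no ¬interior′ with refl ← at-last⇒u a e′ (≤-antisym a<n (≮⇒≥ ¬interior′)) with z ≟ v
    ...     | yes refl = v-covered
    ...     | no  z≢v  = covered-mono (others-covered z w~z z≢v)

    disjoint′ : ∀ i j → i ≢ j → ∀ z → z ∈ₗ Q′ i → ¬ z ∈ₗ Q′ j
    disjoint′ i j i≢j z z∈i z∈j with drop-Q′⁻ i 1 z∈i | drop-Q′⁻ j 1 z∈j
    ... | inj₁ z∈i′          | inj₁ z∈j′          = disjoint i j i≢j z z∈i′ z∈j′
    ... | inj₁ z∈i′          | inj₂ (_ , refl)    = v-uncovered (i , there z∈i′)
    ... | inj₂ (_ , refl)    | inj₁ z∈j′          = v-uncovered (j , there z∈j′)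
    ... | inj₂ (refl , _)    | inj₂ (refl , _)    = i≢j refl

    -- Drop the choice of u, the only choice that is valid for Q′ but not for Q.
    restrict : (Fin k → Maybe ℕ) → Fin k → Maybe ℕ
    restrict c i with c i
    ... | nothing = nothing
    ... | just j with suc j <? length (Q i)
    ...   | yes _ = just j
    ...   | no  _ = nothing

    restrict⁻ : ∀ c i {j} → restrict c i ≡ just j → c i ≡ just j × suc j < length (Q i)
    restrict⁻ c i e with c i
    ... | just j with suc j <? length (Q i)
    restrict⁻ c i refl | just j | yes valid = refl , valid

    restrict-keeps : ∀ c i {j} → c i ≡ just j → suc j < length (Q i) → restrict c i ≡ just j
    restrict-keeps c i {j} ci≡j valid rewrite ci≡j with suc j <? length (Q i)
    ... | yes _      = refl
    ... | no ¬valid = ⊥-elim (¬valid valid)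

    beyond′⇒beyond⊎v : ∀ c z → Beyond G Q′ c z → Beyond G Q (restrict c) z ⊎ z ≡ v
    beyond′⇒beyond⊎v c z (i , j , ci≡j , z∈) with drop-Q′⁻ i (suc (suc j)) z∈
    ... | inj₁ z∈′      = inj₁ (i , j , restrict-keeps c i ci≡j (∈-drop⇒< (Q i) (suc j) z∈′) , z∈′)
    ... | inj₂ (_ , z≡v) = inj₂ z≡v

    beyond⇒beyond′ : ∀ c z → Beyond G Q (restrict c) z → Beyond G Q′ c z
    beyond⇒beyond′ c z (i , j , e , z∈) = i , j , proj₁ (restrict⁻ c i e) , drop-Q⊆Q′ i (suc (suc j)) z∈

    choice′ : ChoiceConditionᴺ G Q′
    choice′ c (i₁ , j₁ , ci₁≡j₁) valid with any? (λ i → just? (restrict c i))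
    ... | yes (i , j , e) with choice (restrict c) (i , j , e) (λ i _ e → proj₂ (restrict⁻ c i e))
    ...   | i′ , j′ , w , e′ , at , exactly =
      i′ , j′ , w , proj₁ (restrict⁻ c i′ e′) , prefix i′ (suc j′) at ,
      ExactlyOneNeighbourIn-transfer G exactly (beyond⇒beyond′ c) back
      where
      back : ∀ z → Beyond G Q′ c z → Adj G w z → Beyond G Q (restrict c) z
      back z z∈ w~z with beyond′⇒beyond⊎v c z z∈
      ... | inj₁ z∈′  = z∈′
      ... | inj₂ refl = ⊥-elim (¬adjacent-interior i′ (suc j′) at (s≤s (proj₂ (restrict⁻ c i′ e′))) w~z)
    choice′ c (i₁ , j₁ , ci₁≡j₁) valid | no none
      with <⇒nth (x ∷ Q′ i₁) (suc (suc j₁)) (s≤s (valid i₁ j₁ ci₁≡j₁))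
    ... | _ , at with prefix⁻ i₁ (suc (suc j₁)) at
    ...   | inj₁ at′ = ⊥-elim (none (i₁ , j₁ , restrict-keeps c i₁ ci₁≡j₁ (≤-pred (nth⇒< (x ∷ Q i₁) _ at′))))
    ...   | inj₂ (refl , last , _) with refl ← suc-injective (trans (suc-injective last) (sym u-last)) =
      i₀ , a₀ , u , ci₁≡j₁ , prefix i₀ (suc a₀) u-at , v , (v-beyond , u~v) , only-v
      where
      v-beyond : Beyond G Q′ c v
      v-beyond = i₀ , a₀ , ci₁≡j₁ ,
                 nth⇒∈-drop (x ∷ Q′ i₀) _ (suc (suc a₀)) v-at-end (≤-reflexive (cong suc u-last))
      only-v : ∀ z → Beyond G Q′ c z → Adj G u z → z ≡ v
      only-v z z∈ _ with beyond′⇒beyond⊎v c z z∈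
      ... | inj₁ (i , j , e , _) = ⊥-elim (none (i , j , e))
      ... | inj₂ z≡v             = z≡v

    chains′ : ForcingChains Q′
    chains′ = record
      { unique    = updateAt-elim (λ _ L → Unique (x ∷ L)) Q i₀ (_∷ʳ v)
                      (Unique-∷ʳ (unique i₀) (λ v∈ → v-uncovered (i₀ , v∈))) (λ i _ → unique i)
      ; induced   = updateAt-elim (λ _ L → IsInducedPathᴺ G (x ∷ L)) Q i₀ (_∷ʳ v)
                      (IsInducedPathᴺ-∷ʳ G (x ∷ Q i₀) (induced i₀) v-after-u) (λ i _ → induced i)
      ; disjoint  = disjoint′
      ; nonempty  = updateAt-elim (λ _ L → 0 < length L) Q i₀ (_∷ʳ v)
                      (subst (0 <_) (sym (length-∷ʳ (Q i₀) v)) (s≤s z≤n)) (λ i _ → nonempty i)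
      ; saturated = updateAt-elim (λ _ L → ∀ a {w} → nth (x ∷ L) a ≡ just w → suc a < length (x ∷ L) →
                                            ∀ z → Adj G w z → Covered Q′ z) Q i₀ (_∷ʳ v)
                      saturated-i₀ (λ i _ a e interior z w~z → covered-mono (saturated i a e interior z w~z))
      ; choice    = choice′
      ; S-covered = λ s s∈S → covered-mono (S-covered s s∈S)
      }

    μ-decreases : μ Q′ < μ Q
    μ-decreases = ∑-mono-< fewer v strictly-fewer
      where
      fewer : ∀ z → uncovered Q′ z ≤ uncovered Q z
      fewer z with covered? Q z | covered? Q′ z
      ... | yes z-covered | no z-uncovered′ = ⊥-elim (z-uncovered′ (covered-mono z-covered))
      ... | yes _         | yes _           = z≤n
      ... | no  _         | yes _           = z≤n
      ... | no  _         | no  _           = ≤-refl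
      strictly-fewer : uncovered Q′ v < uncovered Q v
      strictly-fewer with covered? Q v | covered? Q′ v
      ... | yes v-covered | _              = ⊥-elim (v-uncovered v-covered)
      ... | no  _         | no v-uncovered′ = ⊥-elim (v-uncovered′ v-covered)
      ... | no  _         | yes _          = s≤s z≤n

  step : ∀ Q → ForcingChains Q → (∀ v → Covered Q v) ⊎ Σ Chains λ Q′ → ForcingChains Q′ × μ Q′ < μ Q
  step Q chains with force? Q
  ... | no no-force = inj₁ (no-force⇒all-covered chains no-force)
  ... | yes (u , v , f@(_ , u~v , v-uncovered , others-covered)) with forcer-terminal chains f
  ...   | i₀ , a₀ , u-at , u-last = inj₂ (Q′ , chains′ , μ-decreases)
    where open Extend chains u~v v-uncovered others-covered u-at u-last

  Q₀ : Chains
  Q₀ i = [ nb i ]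

  chains₀ : ForcingChains Q₀
  chains₀ = record
    { unique    = λ i → (Adj⇒≢ G (nb-adjacent i) ∷ []) ∷ [] ∷ []
    ; induced   = induced₀
    ; disjoint  = λ { i j i≢j z (here refl) (here nbi≡nbj) → i≢j (nb-injective nbi≡nbj) }
    ; nonempty  = λ _ → s≤s z≤n
    ; saturated = saturated₀
    ; choice    = λ { c (i , j , ci≡j) valid → case valid i j ci≡j of λ { (s≤s ()) } }
    ; S-covered = S-covered₀
    }
    where
    covered-nb : ∀ {z} → Adj G x z → Covered Q₀ z
    covered-nb x~z with nb-onto x~z
    ... | i , refl = i , there (here refl)
    induced₀ : ∀ i → IsInducedPathᴺ G (x ∷ Q₀ i)
    induced₀ i zero          zero          refl refl = mk⇔ (⊥-elim ∘ Adj-irrefl G) λ { (inj₁ ()) ; (inj₂ ()) }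
    induced₀ i zero          (suc zero)    refl refl = mk⇔ (λ _ → inj₁ refl) (λ _ → nb-adjacent i)
    induced₀ i (suc zero)    zero          refl refl = mk⇔ (λ _ → inj₂ refl) (λ _ → Adj-sym G (nb-adjacent i))
    induced₀ i (suc zero)    (suc zero)    refl refl = mk⇔ (⊥-elim ∘ Adj-irrefl G) λ { (inj₁ ()) ; (inj₂ ()) }
    induced₀ i zero          (suc (suc b)) _    ()
    induced₀ i (suc zero)    (suc (suc b)) _    ()
    induced₀ i (suc (suc a)) b             ()   _
    saturated₀ : ∀ i a {w} → nth (x ∷ Q₀ i) a ≡ just w → suc a < length (x ∷ Q₀ i) →
                 ∀ z → Adj G w z → Covered Q₀ z
    saturated₀ i zero       refl _ z x~z = covered-nb x~z
    saturated₀ i (suc zero) refl (s≤s (s≤s ()))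
    S-covered₀ : ∀ s → s ∈ S → Covered Q₀ s
    S-covered₀ s s∈S with S⊆N[x] s s∈S
    ... | inj₁ refl = i₁ , here refl
    ... | inj₂ x~s  = covered-nb x~s

  covering-chains : Σ Chains λ Q → ForcingChains Q × (∀ v → Covered Q v)
  covering-chains = iterate ForcingChains (λ Q → ∀ v → Covered Q v) μ step Q₀ chains₀

firstForce⇒internallyParallelPaths : ∀ {n} (G : Graph n) {S x v} → IsZeroForcingSet G S → FirstForce G S x v →
                                     ∣ S ∣ ≤ degree G x → IsGraphOfInternallyParallelPaths G (degree G x)
firstForce⇒internallyParallelPaths G {S} {x} zfs ff ∣S∣≤degree =
  x , Q , (λ i → ᴺ⇒isInducedPath G (x ∷ Q i) (unique i) (induced i)) , disjoint , all-covered ,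
  choiceConditionᴺ⇒ G Q choice
  where
  N[x] = nbhd G x
  open FromZeroForcingSet G zfs x (enumerate N[x]) (∈nbhd⇒Adj G ∘ enumerate-∈ N[x]) (enumerate-injective N[x])
         (enumerate-onto N[x] ∘ Adj⇒∈nbhd G) (firstForce⇒⊆closedNbhd G ff ∣S∣≤degree)
         (proj₁ (enumerate-onto N[x] (Adj⇒∈nbhd G (FirstForce.adjacent ff))))
  Q = proj₁ covering-chains
  all-covered = proj₂ (proj₂ covering-chains)
  open FromZeroForcingSet.ForcingChains (proj₁ (proj₂ covering-chains))

module _ {n} (G : Graph (suc n)) where

  zeroForcingSet⇒internallyParallelPaths : ∀ {S} → IsZeroForcingSet G S → ∣ S ∣ ≡ minDegree G →
                                           IsGraphOfInternallyParallelPaths G (minDegree G)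
  zeroForcingSet⇒internallyParallelPaths {S} zfs ∣S∣≡δ with full⊎missing S
  ... | inj₁ full = ⊥-elim (<⇒≱ (minDegree<order G) (subst (suc n ≤_) ∣S∣≡δ (full⇒n≤∣p∣ full)))
  ... | inj₂ (_ , v∉S) with missing⇒firstForce G zfs v∉S
  ...   | x , _ , ff =
    subst (IsGraphOfInternallyParallelPaths G) degree≡δ (firstForce⇒internallyParallelPaths G zfs ff ∣S∣≤degree)
    where
    ∣S∣≤degree : ∣ S ∣ ≤ degree G x
    ∣S∣≤degree = subst (_≤ degree G x) (sym ∣S∣≡δ) (minDegree≤degree G x)
    degree≡δ : degree G x ≡ minDegree G
    degree≡δ = ≤-antisym (subst (degree G x ≤_) ∣S∣≡δ (firstForce⇒degree≤ G ff)) (minDegree≤degree G x)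

corollary5p4 : (n : ℕ) (G : Graph (suc n)) →
    ZeroForcingNumberIs G (minDegree G) ⇔ IsGraphOfInternallyParallelPaths G (minDegree G)
corollary5p4 n G =
  mk⇔ (λ ((S , zfs , ∣S∣≡δ) , _) → zeroForcingSet⇒internallyParallelPaths G zfs ∣S∣≡δ) paths⇒Z≡δ
  where
  paths⇒Z≡δ : IsGraphOfInternallyParallelPaths G (minDegree G) → ZeroForcingNumberIs G (minDegree G)
  paths⇒Z≡δ paths with internallyParallelPaths⇒zeroForcingSet G (minDegree G) paths
  ... | S₀ , S₀-forces , ∣S₀∣≤δ with superset-of-size S₀ (minDegree G) ∣S₀∣≤δ (<⇒≤ (minDegree<order G))
  ...   | S , S₀⊆S , ∣S∣≡δ =
    (S , (λ v → Blue-mono G S₀⊆S (S₀-forces v)) , ∣S∣≡δ) , λ _ → minDegree≤∣zeroForcingSet∣ G
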